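{- Let $x$ be a word in the alphabet $\Gamma$ and $\lambda\in\mathbf Y$. Then $u_x(\lambda)$ equals the partition whose conjugate is $(\lambda'_1+w_1(x),\lambda'_2+w_2(x),\dots)$ if $\lambda'_i-\lambda'_{i+1}\ge\alpha_i(x)$ for all $i\ge1$, and $u_x(\lambda)=0$ otherwise.
   Context: A partition $\lambda$ is a nonincreasing sequence of nonnegative integers with finite sum; $\lambda'$ is its conjugate ($\lambda'_i$ = number of boxes in column $i$). $\mathbf Y$ is the set of partitions. $\Gamma=\{1,2,\dots\}\cup\{\bar1,\bar2,\dots\}$. For $i\ge1$, the operator $u_i$ on $\mathbf C[\mathbf Y]$ sends $\lambda$ to the partition obtained by adding a box to column $i$ (i.e. increasing $\lambda'_i$ by 1) if the result is a partition, and to $0$ otherwise; $d_i=u_{\bar i}$ sends $\lambda$ to the partition obtained by removing a box from column $i$ (decreasing $\lambda'_i$ by 1) if the result is a partition, and to $0$ otherwise. For a word $x=x_1\cdots x_\ell$ over $\Gamma$, $u_x=u_{x_1}\cdots u_{x_\ell}$ (composition, so $u_{x_\ell}$ is applied first). The weight of $x$ is $w(x)=(w_1(x),w_2(x),\dots)$ with $w_i(x)$ = (number of occurrences of $i$ in $x$) $-$ (number of occurrences of $\bar i$ in $x$). The $\alpha$-vector is $\alpha(x)=(\alpha_1(x),\alpha_2(x),\dots)$ with $\alpha_i(x)=\max\{w_{i+1}(\tilde x)-w_i(\tilde x)\}$ over all suffixes $\tilde x=x_j\cdots x_\ell$, $1\le j\le \ell+1$ (including the empty suffix, so $\alpha_i(x)\ge0$).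 -}

module Defs where

open import Data.Nat using (ℕ; zero; suc; _≤?_; _≟_; _<_)
open import Data.Integer using (ℤ; +_; _-_; _⊔_)
open import Data.List using (List; []; _∷_; length; filter)
open import Data.Maybe using (Maybe; just; nothing; _>>=_)
open import Data.Maybe as Maybe using ()
open import Data.Product using (_×_)
open import Data.List.Relation.Unary.All using (All)
open import Data.List.Relation.Unary.Linked using (Linked)
open import Relation.Nullary using (yes; no)
open import Data.Nat using (_≥_)
open import Data.Bool using (Bool; true; false)
open import Relation.Nullary.Decidable using (⌊_⌋)

-- A partition is represented by its list of (row) parts
-- λ₁ ≥ λ₂ ≥ … > 0 (trailing zeros omitted).
-- COLUMNS ARE 0-INDEXED IN THIS FILE: the index k : ℕ stands for the
-- paper's column k+1.  So `conj ν k` is the paper's λ'_{k+1},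
-- `up k` is the letter k+1 ∈ Γ, `down k` is the letter \bar{k+1}, etc.

IsPartition : List ℕ → Set
IsPartition ν = Linked _≥_ ν × All (0 <_) ν

conj : List ℕ → ℕ → ℕ
conj ν k = length (filter (suc k ≤?_) ν)

data Γ : Set where
  up   : ℕ → Γ
  down : ℕ → Γ

-- u_{k+1}: add a box to column k+1 (nothing = the zero vector).
-- Scan the rows; rows of length ≥ k+1 are kept; the first row of
-- length < k+1 must have length exactly k, and gets the new box.
addBox : ℕ → List ℕ → Maybe (List ℕ)
addBox zero    []       = just (1 ∷ [])
addBox (suc k) []       = nothing
addBox k       (p ∷ ps) with suc k ≤? p
... | yes _ = Maybe.map (p ∷_) (addBox k ps)
... | no  _ with p ≟ k
...   | yes _ = just (suc p ∷ ps)
...   | no  _ = nothing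

consPos : ℕ → List ℕ → List ℕ
consPos zero    ps = ps
consPos (suc n) ps = suc n ∷ ps

headGE? : (k : ℕ) → List ℕ → Bool
headGE? k []       = false
headGE? k (q ∷ qs) = ⌊ suc k ≤? q ⌋

-- d_{k+1}: remove a box from column k+1 (nothing = the zero vector).
-- The last row of length ≥ k+1 must have length exactly k+1; it loses
-- its last box (and disappears if it becomes empty).
removeBox : ℕ → List ℕ → Maybe (List ℕ)
removeBox k []       = nothing
removeBox k (p ∷ ps) with suc k ≤? p | headGE? k ps
... | no  _ | _          = nothing
... | yes _ | true  = Maybe.map (p ∷_) (removeBox k ps)
... | yes _ | false with p ≟ suc k
...   | yes _ = just (consPos k ps)
...   | no  _ = nothing

uLetter : Γ → List ℕ → Maybe (List ℕ)
uLetter (up k)   = addBox k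
uLetter (down k) = removeBox k

-- u_x = u_{x₁} ∘ ⋯ ∘ u_{x_ℓ}  (last letter applied first)
uWord : List Γ → List ℕ → Maybe (List ℕ)
uWord []       ν = just ν
uWord (a ∷ xs) ν = uWord xs ν >>= uLetter a

countUp countDown : ℕ → List Γ → ℕ
countUp k [] = 0
countUp k (up j ∷ xs) with j ≟ k
... | yes _ = suc (countUp k xs)
... | no  _ = countUp k xs
countUp k (down j ∷ xs) = countUp k xs
countDown k [] = 0
countDown k (down j ∷ xs) with j ≟ k
... | yes _ = suc (countDown k xs)
... | no  _ = countDown k xs
countDown k (up j ∷ xs) = countDown k xs

w : ℕ → List Γ → ℤ
w k x = + countUp k x - + countDown k x

-- α k x = paper's α_{k+1}(x) = max over all suffixes (incl. empty)
-- of w_{k+2} - w_{k+1}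
α : ℕ → List Γ → ℤ
α k []       = + 0
α k (a ∷ xs) = (w (suc k) (a ∷ xs) - w k (a ∷ xs)) ⊔ α k xs

-- Induct on the word, peeling off its first letter a (applied last).  For a partition μ,
-- u_a μ ≠ 0 exactly when μ has a removable corner in the column where u_a needs one, which in
-- terms of gaps μ'_j - μ'_{j+1} says slope_j(a) = w_{j+1}(a) - w_j(a) ≤ μ'_j - μ'_{j+1} for all j;
-- u_a then adds w(a) to μ'.  If μ = u_x λ, the gaps of μ are those of λ minus slope_j(x), and
-- slope(a x) = slope(a) + slope(x), so this letter condition reads slope_j(a x) ≤ λ'_j - λ'_{j+1}.
-- Since α_j(a x) = max(slope_j(a x), α_j(x)), the condition for a x on λ is exactly the
-- condition for x on λ together with the letter condition on u_x λ.
module Submission where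

open import Defs
open import Data.Nat using (ℕ; zero; suc; z≤n; _≟_)
import Data.Nat as ℕ
open import Data.Nat.Properties using (≟-diag; 1+n≢n)
open import Data.List using (List; []; _∷_)
open import Data.Maybe using (Maybe; just; nothing; _>>=_)
import Data.Maybe as Maybe
open import Data.Maybe.Properties using (map-id)
open import Data.Product using (_×_; _,_; ∃-syntax; proj₁; proj₂)
open import Data.Sum using (_⊎_; inj₁; inj₂)
open import Data.Unit using (⊤; tt)
open import Function using (_∘_; id)
open import Function.Bundles using (_⇔_; mk⇔; Equivalence)
open import Relation.Nullary using (¬_; yes; no; contradiction)
open import Relation.Binary.PropositionalEquality

open Equivalence using (to; from)

DefinedIff : Set → Maybe (List ℕ) → (List ℕ → Set) → Set
DefinedIff C r Post =
  (C × ∃[ μ ] (r ≡ just μ × IsPartition μ × Post μ)) ⊎ (¬ C × r ≡ nothing)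

DefinedIff-map : ∀ {C C′ r r′ Post Post′} (f : List ℕ → List ℕ) →
  r′ ≡ Maybe.map f r → C′ ⇔ C →
  (∀ {μ} → IsPartition μ → Post μ → IsPartition (f μ) × Post′ (f μ)) →
  DefinedIff C r Post → DefinedIff C′ r′ Post′
DefinedIff-map f refl C′⇔C transport (inj₁ (c , μ , refl , μ-partition , post)) =
  inj₁ (from C′⇔C c , f μ , refl , transport μ-partition post)
DefinedIff-map f refl C′⇔C transport (inj₂ (¬c , refl)) = inj₂ (¬c ∘ to C′⇔C , refl)

definedIff⇒cases : ∀ {C r Post} → DefinedIff C r Post →
  (C → ∃[ μ ] (r ≡ just μ × IsPartition μ × Post μ)) × (¬ C → r ≡ nothing)
definedIff⇒cases (inj₁ (c , result))     = (λ _ → result) , (λ ¬c → contradiction c ¬c)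
definedIff⇒cases (inj₂ (¬c , undefined)) = (λ c → contradiction c ¬c) , (λ _ → undefined)

-- A separate module, so that the ℕ operators opened here do not clash with the ℤ operators
-- of the statement.
module Columns where
  open import Data.Nat using (s≤s; s≤s⁻¹; z<s; s<s; s<s⁻¹; _+_; _≤_; _<_; _≥_; _≰_; _≤?_)
  open import Data.Nat.Properties
  open import Data.List using (length)
  open import Data.List.Properties using (filter-accept; filter-reject; filter-none)
  open import Data.List.Relation.Unary.All as All using (All; []; _∷_)
  open import Data.List.Relation.Unary.Linked as Linked using (Linked; []; [-]; _∷_)
  open import Data.List.Relation.Unary.Linked.Properties using (Linked⇒All)
  open import Data.Bool using (true; false)
  open import Function using (flip)
  open import Relation.Binary using (tri<; tri≈; tri>)

  conj-accept : ∀ {j p} ps → suc j ≤ p → conj (p ∷ ps) j ≡ suc (conj ps j)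
  conj-accept ps j<p = cong length (filter-accept (suc _ ≤?_) j<p)

  conj-reject : ∀ {j p} ps → suc j ≰ p → conj (p ∷ ps) j ≡ conj ps j
  conj-reject ps j≮p = cong length (filter-reject (suc _ ≤?_) j≮p)

  conj-antitone : ∀ ν j → conj ν (suc j) ≤ conj ν j
  conj-antitone [] j = z≤n
  conj-antitone (p ∷ ps) j with suc (suc j) ≤? p | suc j ≤? p
  ... | yes j+1<p | yes j<p
    rewrite conj-accept ps j+1<p | conj-accept ps j<p = s≤s (conj-antitone ps j)
  ... | yes j+1<p | no j≮p = contradiction (<⇒≤ j+1<p) j≮p
  ... | no j+1≮p | yes j<p
    rewrite conj-reject ps j+1≮p | conj-accept ps j<p = m≤n⇒m≤1+n (conj-antitone ps j)
  ... | no j+1≮p | no j≮p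
    rewrite conj-reject ps j+1≮p | conj-reject ps j≮p = conj-antitone ps j

  conj-vanishes : ∀ {j} ν → All (_≤ j) ν → conj ν j ≡ 0
  conj-vanishes ν ν≤j = cong length (filter-none (suc _ ≤?_) (All.map ≤⇒≯ ν≤j))

  bounded-by-head : ∀ {p j} ps → Linked _≥_ (p ∷ ps) → p ≤ j → All (_≤ j) (p ∷ ps)
  bounded-by-head ps sorted p≤j = Linked⇒All (flip ≤-trans) p≤j sorted

  conj-tail-vanishes : ∀ {p j} ps → Linked _≥_ (p ∷ ps) → p ≤ j → conj ps j ≡ 0
  conj-tail-vanishes ps sorted p≤j = conj-vanishes ps (All.tail (bounded-by-head ps sorted p≤j))

  cons-partition : ∀ {p μ} → 0 < p → IsPartition μ → conj μ p ≡ 0 → IsPartition (p ∷ μ)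
  cons-partition {μ = []} 0<p _ _ = [-] , 0<p ∷ []
  cons-partition {p} {q ∷ qs} 0<p (sorted , pos) conj≡0 with suc p ≤? q
  ... | yes p<q = contradiction (trans (sym (conj-accept qs p<q)) conj≡0) λ ()
  ... | no p≮q = ≮⇒≥ p≮q ∷ sorted , 0<p ∷ pos

  tail-partition : ∀ {p ps} → IsPartition (p ∷ ps) → IsPartition ps
  tail-partition (sorted , pos) = Linked.tail sorted , All.tail pos

  countUp-other : ∀ {k j} → k ≢ j → countUp j (up k ∷ []) ≡ 0
  countUp-other {k} {j} k≢j with k ≟ j
  ... | yes k≡j = contradiction k≡j k≢j
  ... | no _ = refl

  countDown≡countUp : ∀ k j → countDown j (down k ∷ []) ≡ countUp j (up k ∷ [])
  countDown≡countUp k j with k ≟ j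
  ... | yes _ = refl
  ... | no _ = refl

  countUp-cons : ∀ j a xs → countUp j (a ∷ xs) ≡ countUp j (a ∷ []) + countUp j xs
  countUp-cons j (up m) xs with m ≟ j
  ... | yes _ = refl
  ... | no _ = refl
  countUp-cons j (down m) xs = refl

  countDown-cons : ∀ j a xs → countDown j (a ∷ xs) ≡ countDown j (a ∷ []) + countDown j xs
  countDown-cons j (up m) xs = refl
  countDown-cons j (down m) xs with m ≟ j
  ... | yes _ = refl
  ... | no _ = refl

  BoxAdded : ℕ → List ℕ → List ℕ → Set
  BoxAdded k ν μ = ∀ j → conj μ j ≡ countUp j (up k ∷ []) + conj ν j

  boxAdded-cons : ∀ k p {ν μ} → BoxAdded k ν μ → BoxAdded k (p ∷ ν) (p ∷ μ)
  boxAdded-cons k p {ν} {μ} added j with suc j ≤? p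
  ... | yes j<p rewrite conj-accept μ j<p | conj-accept ν j<p | added j = sym (+-suc _ _)
  ... | no j≮p rewrite conj-reject μ j≮p | conj-reject ν j≮p = added j

  boxAdded-row : ∀ k ps → BoxAdded k (k ∷ ps) (suc k ∷ ps)
  boxAdded-row k ps j with k ≟ j
  ... | yes refl rewrite conj-accept ps (≤-refl {suc k}) | conj-reject ps (<-irrefl {k} refl) = refl
  ... | no k≢j with suc j ≤? k
  ...   | yes j<k rewrite conj-accept ps (m≤n⇒m≤1+n j<k) | conj-accept ps j<k = refl
  ...   | no j≮k rewrite conj-reject ps j≮k = conj-reject ps (j≮k ∘ j<k+1⇒j<k)
    where
    j<k+1⇒j<k : suc j ≤ suc k → suc j ≤ k
    j<k+1⇒j<k j<k+1 = ≤∧≢⇒< (s≤s⁻¹ j<k+1) (k≢j ∘ sym)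

  -- The bottom box of column k is a removable corner, i.e. some part equals k + 1.
  Removable : ℕ → List ℕ → Set
  Removable k ν = conj ν (suc k) < conj ν k

  Addable : ℕ → List ℕ → Set
  Addable zero    ν = ⊤
  Addable (suc k) ν = Removable k ν

  next-column-empty⇒removable : ∀ {k ν} → conj ν (suc k) ≡ 0 → 0 < conj ν k → Removable k ν
  next-column-empty⇒removable {k} {ν} ≡0 = subst (λ n → n < conj ν k) (sym ≡0)

  column-empty⇒¬removable : ∀ {k ν} → conj ν k ≡ 0 → ¬ Removable k ν
  column-empty⇒¬removable {k} {ν} ≡0 = n≮0 ∘ subst (conj ν (suc k) <_) ≡0

  removable-head : ∀ {k} ps → Linked _≥_ (suc k ∷ ps) → Removable k (suc k ∷ ps)
  removable-head {k} ps sorted =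
    next-column-empty⇒removable {k} {suc k ∷ ps}
      (conj-vanishes (suc k ∷ ps) (bounded-by-head ps sorted ≤-refl))
      (subst (0 <_) (sym (conj-accept {k} ps ≤-refl)) z<s)

  ¬removable-short : ∀ {k p} ps → Linked _≥_ (p ∷ ps) → p ≤ k → ¬ Removable k (p ∷ ps)
  ¬removable-short {k} {p} ps sorted p≤k =
    column-empty⇒¬removable {k} {p ∷ ps} (conj-vanishes (p ∷ ps) (bounded-by-head ps sorted p≤k))

  removable-cons : ∀ {k p} ps → suc (suc k) ≤ p → Removable k (p ∷ ps) ⇔ Removable k ps
  removable-cons ps k+1<p
    rewrite conj-accept ps k+1<p | conj-accept ps (<⇒≤ k+1<p) = mk⇔ s<s⁻¹ s<s

  removable-cons-sorted : ∀ {k p} ps → Linked _≥_ (p ∷ ps) → suc k ≤ p → 0 < conj ps k →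
    Removable k (p ∷ ps) ⇔ Removable k ps
  removable-cons-sorted {k} {p} ps sorted k<p ps-reaches-k with suc (suc k) ≤? p
  ... | yes k+1<p = removable-cons ps k+1<p
  ... | no k+1≮p =
    mk⇔ (λ _ → next-column-empty⇒removable {k} {ps}
                  (conj-tail-vanishes ps sorted p≤k+1) ps-reaches-k)
        (λ _ → next-column-empty⇒removable {k} {p ∷ ps}
                  (conj-vanishes (p ∷ ps) (bounded-by-head ps sorted p≤k+1))
                  (subst (0 <_) (sym (conj-accept ps k<p)) z<s))
    where
    p≤k+1 : p ≤ suc k
    p≤k+1 = ≮⇒≥ k+1≮p

  addable-cons : ∀ {k p} ps → suc k ≤ p → Addable k (p ∷ ps) ⇔ Addable k ps
  addable-cons {zero}  ps _   = mk⇔ _ _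
  addable-cons {suc k} ps k<p = removable-cons ps k<p

  addable-exact-row : ∀ {k} ps → Linked _≥_ (k ∷ ps) → Addable k (k ∷ ps)
  addable-exact-row {zero}  ps _      = tt
  addable-exact-row {suc k} ps sorted = removable-head ps sorted

  ¬addable-short-row : ∀ {k p} ps → Linked _≥_ (p ∷ ps) → p < k → ¬ Addable k (p ∷ ps)
  ¬addable-short-row {suc k} ps sorted p<k = ¬removable-short ps sorted (s≤s⁻¹ p<k)

  -- addBox k (p ∷ ps) is stuck until k is a constructor, hence these unfolding lemmas.
  addBox-long-row : ∀ k {p} ps → suc k ≤ p → addBox k (p ∷ ps) ≡ Maybe.map (p ∷_) (addBox k ps)
  addBox-long-row zero {p} ps k<p with 1 ≤? p
  ... | yes _ = refl
  ... | no k≮p = contradiction k<p k≮p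
  addBox-long-row (suc k) {p} ps k<p with suc (suc k) ≤? p
  ... | yes _ = refl
  ... | no k≮p = contradiction k<p k≮p

  addBox-exact-row : ∀ k ps → addBox k (k ∷ ps) ≡ just (suc k ∷ ps)
  addBox-exact-row zero ps = refl
  addBox-exact-row (suc k) ps with suc (suc k) ≤? suc k
  ... | yes k<k = contradiction k<k (<-irrefl refl)
  ... | no _ rewrite ≟-diag (refl {x = suc k}) = refl

  addBox-short-row : ∀ k {p} ps → p < k → addBox k (p ∷ ps) ≡ nothing
  addBox-short-row (suc k) {p} ps p<k with suc (suc k) ≤? p
  ... | yes k<p = contradiction (<-trans p<k k<p) (<-irrefl refl)
  ... | no _ with p ≟ suc k
  ...   | yes refl = contradiction p<k (<-irrefl refl)
  ...   | no _ = refl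

  addBox-spec : ∀ k {ν} → IsPartition ν → DefinedIff (Addable k ν) (addBox k ν) (BoxAdded k ν)
  addBox-spec zero    {[]} _ =
    inj₁ (tt , 1 ∷ [] , refl , ([-] , z<s ∷ []) , λ { zero → refl ; (suc j) → refl })
  addBox-spec (suc k) {[]} _ = inj₂ (n≮0 , refl)
  addBox-spec k {p ∷ ps} ν-partition@(sorted , 0<p ∷ _) with <-cmp p k
  ... | tri< p<k _ _ = inj₂ (¬addable-short-row ps sorted p<k , addBox-short-row k ps p<k)
  ... | tri≈ _ refl _ =
    inj₁ (addable-exact-row ps sorted , suc p ∷ ps , addBox-exact-row p ps ,
          cons-partition z<s (tail-partition ν-partition) (conj-tail-vanishes ps sorted (n≤1+n p)) ,
          boxAdded-row p ps)
  ... | tri> _ _ k<p =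
    DefinedIff-map (p ∷_) (addBox-long-row k ps k<p) (addable-cons ps k<p) extend
                   (addBox-spec k (tail-partition ν-partition))
    where
    extend : ∀ {μ} → IsPartition μ → BoxAdded k ps μ →
      IsPartition (p ∷ μ) × BoxAdded k (p ∷ ps) (p ∷ μ)
    extend μ-partition added =
      cons-partition 0<p μ-partition
        (trans (added p)
               (cong₂ _+_ (countUp-other (<⇒≢ k<p)) (conj-tail-vanishes ps sorted ≤-refl))) ,
      boxAdded-cons k p added

  headGE?-true : ∀ {k} ps → headGE? k ps ≡ true → 0 < conj ps k
  headGE?-true {k} (q ∷ qs) head≥k with suc k ≤? q
  headGE?-true {k} (q ∷ qs) head≥k | yes k<q = subst (0 <_) (sym (conj-accept qs k<q)) z<s
  headGE?-true {k} (q ∷ qs) ()     | no _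

  headGE?-false : ∀ {k} ps → Linked _≥_ ps → headGE? k ps ≡ false → conj ps k ≡ 0
  headGE?-false [] _ _ = refl
  headGE?-false {k} (q ∷ qs) sorted head≱k with suc k ≤? q
  headGE?-false {k} (q ∷ qs) sorted ()     | yes _
  headGE?-false {k} (q ∷ qs) sorted head≱k | no k≮q =
    conj-vanishes (q ∷ qs) (bounded-by-head qs sorted (≮⇒≥ k≮q))

  consPos-conj : ∀ k ps j → conj (consPos k ps) j ≡ conj (k ∷ ps) j
  consPos-conj zero    ps j = sym (conj-reject {j} {0} ps λ ())
  consPos-conj (suc k) ps j = refl

  consPos-partition : ∀ {k ps} → IsPartition ps → conj ps k ≡ 0 → IsPartition (consPos k ps)
  consPos-partition {zero}  ps-partition _  = ps-partition
  consPos-partition {suc k} ps-partition ≡0 = cons-partition z<s ps-partition ≡0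

  removeBox-spec : ∀ k {ν} → IsPartition ν →
    DefinedIff (Removable k ν) (removeBox k ν) (λ μ → BoxAdded k μ ν)
  removeBox-spec k {[]} _ = inj₂ (n≮0 , refl)
  removeBox-spec k {p ∷ ps} ν-partition@(sorted , 0<p ∷ _) with suc k ≤? p | headGE? k ps in head≥k
  ... | no k≮p | _ = inj₂ (¬removable-short ps sorted (≮⇒≥ k≮p) , refl)
  ... | yes k<p | true =
    DefinedIff-map (p ∷_) refl (removable-cons-sorted ps sorted k<p (headGE?-true ps head≥k)) extend
                   (removeBox-spec k (tail-partition ν-partition))
    where
    extend : ∀ {μ} → IsPartition μ → BoxAdded k μ ps →
      IsPartition (p ∷ μ) × BoxAdded k (p ∷ μ) (p ∷ ps)
    extend μ-partition added =
      cons-partition 0<p μ-partition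
        (m+n≡0⇒n≡0 _ (trans (sym (added p)) (conj-tail-vanishes ps sorted ≤-refl))) ,
      boxAdded-cons k p added
  ... | yes k<p | false with p ≟ suc k
  ...   | yes refl =
    inj₁ (removable-head ps sorted , consPos k ps , refl ,
          consPos-partition (tail-partition ν-partition) ps-below-k ,
          λ j → trans (boxAdded-row k ps j)
                      (cong (countUp j (up k ∷ []) +_) (sym (consPos-conj k ps j))))
    where
    ps-below-k : conj ps k ≡ 0
    ps-below-k = headGE?-false ps (Linked.tail sorted) head≥k
  ...   | no p≢k+1 =
    inj₂ (column-empty⇒¬removable {k} {ps} (headGE?-false ps (Linked.tail sorted) head≥k)
            ∘ to (removable-cons ps (≤∧≢⇒< k<p (p≢k+1 ∘ sym))) , refl)

open Columns

open import Data.Integer using (ℤ; +_; -_; -[1+_]; _+_; _-_; _≤_; +≤+)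
import Data.Integer.Properties as ℤ
open import Data.Integer.Tactic.RingSolver using (solve-∀)

gap : List ℕ → ℕ → ℤ
gap ν k = + conj ν k - + conj ν (suc k)

slope : ℕ → List Γ → ℤ
slope k x = w (suc k) x - w k x

Fits : List Γ → List ℕ → Set
Fits x ν = ∀ k → α k x ≤ gap ν k

LetterFits : Γ → List ℕ → Set
LetterFits a μ = ∀ k → slope k (a ∷ []) ≤ gap μ k

Shifted : List ℕ → List Γ → List ℕ → Set
Shifted ν x μ = ∀ k → + conj μ k ≡ + conj ν k + w k x

≤-⇔+≤ : ∀ i j k → i ≤ j - k ⇔ i + k ≤ j
≤-⇔+≤ i j k = mk⇔ (λ i≤j-k → subst (i + k ≤_) (cancel j k) (ℤ.+-monoˡ-≤ k i≤j-k))
                  (λ i+k≤j → subst (_≤ j - k) (add-cancel i k) (ℤ.+-monoˡ-≤ (- k) i+k≤j))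
  where
  cancel : ∀ j k → (j - k) + k ≡ j
  cancel = solve-∀
  add-cancel : ∀ i k → (i + k) - k ≡ i
  add-cancel = solve-∀

gap-nonneg : ∀ ν k → + 0 ≤ gap ν k
gap-nonneg ν k = ℤ.i≤j⇒0≤j-i (+≤+ (conj-antitone ν k))

removable⇔1≤gap : ∀ k ν → Removable k ν ⇔ + 1 ≤ gap ν k
removable⇔1≤gap k ν =
  mk⇔ (from (≤-⇔+≤ (+ 1) (+ conj ν k) (+ conj ν (suc k))) ∘ +≤+)
      (ℤ.drop‿+≤+ ∘ to (≤-⇔+≤ (+ 1) (+ conj ν k) (+ conj ν (suc k))))

w-cons : ∀ j a xs → w j (a ∷ xs) ≡ w j (a ∷ []) + w j xs
w-cons j a xs = begin
  + countUp j (a ∷ xs) - + countDown j (a ∷ xs)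
    ≡⟨ cong₂ (λ u d → + u - + d) (countUp-cons j a xs) (countDown-cons j a xs) ⟩
  + (u₁ ℕ.+ countUp j xs) - + (d₁ ℕ.+ countDown j xs)
    ≡⟨ cong₂ _-_ (ℤ.pos-+ u₁ (countUp j xs)) (ℤ.pos-+ d₁ (countDown j xs)) ⟩
  (+ u₁ + + countUp j xs) - (+ d₁ + + countDown j xs)
    ≡⟨ interchange (+ u₁) (+ countUp j xs) (+ d₁) (+ countDown j xs) ⟩
  w j (a ∷ []) + w j xs ∎
  where
  open ≡-Reasoning
  u₁ = countUp j (a ∷ [])
  d₁ = countDown j (a ∷ [])
  interchange : ∀ u u′ d d′ → (u + u′) - (d + d′) ≡ (u - d) + (u′ - d′)
  interchange = solve-∀

w-up-self : ∀ k → w k (up k ∷ []) ≡ + 1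
w-up-self k rewrite ≟-diag (refl {x = k}) = refl

w-up-other : ∀ {k j} → k ≢ j → w j (up k ∷ []) ≡ + 0
w-up-other k≢j rewrite countUp-other k≢j = refl

w-down-self : ∀ k → w k (down k ∷ []) ≡ -[1+ 0 ]
w-down-self k rewrite ≟-diag (refl {x = k}) = refl

w-down-other : ∀ {k j} → k ≢ j → w j (down k ∷ []) ≡ + 0
w-down-other {k} {j} k≢j rewrite countDown≡countUp k j | countUp-other k≢j = refl

w-down-nonpos : ∀ k j → w j (down k ∷ []) ≤ + 0
w-down-nonpos k j = ℤ.i≤j⇒i-j≤0 {+ 0} {+ countDown j (down k ∷ [])} (+≤+ z≤n)

slope-up-critical : ∀ k → slope k (up (suc k) ∷ []) ≡ + 1
slope-up-critical k rewrite w-up-self (suc k) | w-up-other (1+n≢n {k}) = refl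

slope-up-nonpos : ∀ {k j} → k ≢ suc j → slope j (up k ∷ []) ≤ + 0
slope-up-nonpos {k} {j} k≢j+1 =
  ℤ.i≤j⇒i-j≤0 (subst (_≤ w j (up k ∷ [])) (sym (w-up-other k≢j+1)) (+≤+ z≤n))

slope-down-critical : ∀ k → slope k (down k ∷ []) ≡ + 1
slope-down-critical k rewrite w-down-self k | w-down-other (1+n≢n {k} ∘ sym) = refl

slope-down-nonpos : ∀ {k j} → k ≢ j → slope j (down k ∷ []) ≤ + 0
slope-down-nonpos {k} {j} k≢j =
  ℤ.i≤j⇒i-j≤0 (subst (w (suc j) (down k ∷ []) ≤_) (sym (w-down-other k≢j))
                     (w-down-nonpos k (suc j)))

letterFits-up⇔addable : ∀ k μ → LetterFits (up k) μ ⇔ Addable k μ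
letterFits-up⇔addable k μ = mk⇔ (necessary k) sufficient
  where
  necessary : ∀ k → LetterFits (up k) μ → Addable k μ
  necessary zero    _    = tt
  necessary (suc m) fits =
    from (removable⇔1≤gap m μ) (subst (_≤ gap μ m) (slope-up-critical m) (fits m))

  sufficient : Addable k μ → LetterFits (up k) μ
  sufficient addable j with suc j ≟ k
  ... | yes refl = subst (_≤ gap μ j) (sym (slope-up-critical j)) (to (removable⇔1≤gap j μ) addable)
  ... | no j+1≢k = ℤ.≤-trans (slope-up-nonpos (j+1≢k ∘ sym)) (gap-nonneg μ j)

letterFits-down⇔removable : ∀ k μ → LetterFits (down k) μ ⇔ Removable k μ
letterFits-down⇔removable k μ = mk⇔ necessary sufficient
  where
  necessary : LetterFits (down k) μ → Removable k μ
  necessary fits = from (removable⇔1≤gap k μ) (subst (_≤ gap μ k) (slope-down-critical k) (fits k))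

  sufficient : Removable k μ → LetterFits (down k) μ
  sufficient removable j with j ≟ k
  ... | yes refl =
    subst (_≤ gap μ j) (sym (slope-down-critical j)) (to (removable⇔1≤gap j μ) removable)
  ... | no j≢k = ℤ.≤-trans (slope-down-nonpos (j≢k ∘ sym)) (gap-nonneg μ j)

uLetter-spec : ∀ a {μ} → IsPartition μ →
  DefinedIff (LetterFits a μ) (uLetter a μ) (Shifted μ (a ∷ []))
uLetter-spec (up k) {μ} μ-partition =
  DefinedIff-map id (sym (map-id _)) (letterFits-up⇔addable k μ)
    (λ μ′-partition added → μ′-partition , λ j → gained j (added j))
    (addBox-spec k μ-partition)
  where
  gained : ∀ {m n} j → m ≡ countUp j (up k ∷ []) ℕ.+ n → + m ≡ + n + w j (up k ∷ [])
  gained {n = n} j refl rewrite ℤ.pos-+ (countUp j (up k ∷ [])) n =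
    commute (+ countUp j (up k ∷ [])) (+ n)
    where
    commute : ∀ c n → c + n ≡ n + (c - + 0)
    commute = solve-∀
uLetter-spec (down k) {μ} μ-partition =
  DefinedIff-map id (sym (map-id _)) (letterFits-down⇔removable k μ)
    (λ μ′-partition removed → μ′-partition , λ j → lost j (removed j))
    (removeBox-spec k μ-partition)
  where
  lost : ∀ {m n} j → n ≡ countUp j (up k ∷ []) ℕ.+ m → + m ≡ + n + w j (down k ∷ [])
  lost {m} j refl rewrite countDown≡countUp k j | ℤ.pos-+ (countUp j (up k ∷ [])) m =
    cancel (+ countUp j (up k ∷ [])) (+ m)
    where
    cancel : ∀ c m → m ≡ (c + m) + (+ 0 - c)
    cancel = solve-∀

fits-cons : ∀ a xs ν → Fits (a ∷ xs) ν ⇔ (Fits xs ν × (∀ k → slope k (a ∷ xs) ≤ gap ν k))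
fits-cons a xs ν =
  mk⇔ (λ fits → (λ k → ℤ.≤-trans (ℤ.i≤j⊔i (slope k (a ∷ xs)) (α k xs)) (fits k)) ,
                (λ k → ℤ.≤-trans (ℤ.i≤i⊔j (slope k (a ∷ xs)) (α k xs)) (fits k)))
      (λ (fits , slopes) k → ℤ.⊔-lub (slopes k) (fits k))

slope-cons : ∀ k a xs → slope k (a ∷ xs) ≡ slope k (a ∷ []) + slope k xs
slope-cons k a xs
  rewrite w-cons (suc k) a xs | w-cons k a xs
  = interchange (w (suc k) (a ∷ [])) (w (suc k) xs) (w k (a ∷ [])) (w k xs)
  where
  interchange : ∀ u u′ d d′ → (u + u′) - (d + d′) ≡ (u - d) + (u′ - d′)
  interchange = solve-∀

gap-shifted : ∀ {ν xs μ} → Shifted ν xs μ → ∀ k → gap μ k ≡ gap ν k - slope k xs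
gap-shifted {ν} {xs} shift k
  rewrite shift k | shift (suc k)
  = rearrange (+ conj ν k) (+ conj ν (suc k)) (w k xs) (w (suc k) xs)
  where
  rearrange : ∀ c c′ u u′ → (c + u) - (c′ + u′) ≡ (c - c′) - (u′ - u)
  rearrange = solve-∀

slope-fits-shifted : ∀ {ν xs μ} a → Shifted ν xs μ → ∀ k →
  slope k (a ∷ xs) ≤ gap ν k ⇔ slope k (a ∷ []) ≤ gap μ k
slope-fits-shifted {ν} {xs} {μ} a shift k =
  mk⇔ (λ fits → subst (slope k (a ∷ []) ≤_) (sym μ-gap)
                  (from split (subst (_≤ gap ν k) (slope-cons k a xs) fits)))
      (λ fits → subst (_≤ gap ν k) (sym (slope-cons k a xs))
                  (to split (subst (slope k (a ∷ []) ≤_) μ-gap fits)))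
  where
  μ-gap : gap μ k ≡ gap ν k - slope k xs
  μ-gap = gap-shifted {ν} {xs} {μ} shift k
  split : slope k (a ∷ []) ≤ gap ν k - slope k xs ⇔ slope k (a ∷ []) + slope k xs ≤ gap ν k
  split = ≤-⇔+≤ (slope k (a ∷ [])) (gap ν k) (slope k xs)

shifted-cons : ∀ {ν xs μ μ′} a →
  Shifted ν xs μ → Shifted μ (a ∷ []) μ′ → Shifted ν (a ∷ xs) μ′
shifted-cons {ν} {xs} {μ} {μ′} a shift shift′ k = begin
  + conj μ′ k                             ≡⟨ shift′ k ⟩
  + conj μ k + w k (a ∷ [])               ≡⟨ cong (_+ w k (a ∷ [])) (shift k) ⟩
  (+ conj ν k + w k xs) + w k (a ∷ [])    ≡⟨ swap (+ conj ν k) (w k xs) (w k (a ∷ [])) ⟩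
  + conj ν k + (w k (a ∷ []) + w k xs)    ≡⟨ cong (λ u → + conj ν k + u) (sym (w-cons k a xs)) ⟩
  + conj ν k + w k (a ∷ xs)               ∎
  where
  open ≡-Reasoning
  swap : ∀ c u v → (c + u) + v ≡ c + (v + u)
  swap = solve-∀

uWord-spec : ∀ x {ν} → IsPartition ν → DefinedIff (Fits x ν) (uWord x ν) (Shifted ν x)
uWord-spec [] {ν} ν-partition =
  inj₁ (gap-nonneg ν , ν , refl , ν-partition , λ k → sym (ℤ.+-identityʳ (+ conj ν k)))
uWord-spec (a ∷ xs) {ν} ν-partition with uWord-spec xs ν-partition
... | inj₂ (¬fits , undefined) =
  inj₂ (¬fits ∘ proj₁ ∘ to (fits-cons a xs ν) , cong (_>>= uLetter a) undefined)
... | inj₁ (fits , μ , defined , μ-partition , shift) =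
  DefinedIff-map id (trans (cong (_>>= uLetter a) defined) (sym (map-id _))) fits⇔letterFits
    (λ {μ′} μ′-partition shift′ →
       μ′-partition , shifted-cons {ν} {xs} {μ} {μ′} a shift shift′)
    (uLetter-spec a μ-partition)
  where
  step : ∀ k → slope k (a ∷ xs) ≤ gap ν k ⇔ slope k (a ∷ []) ≤ gap μ k
  step = slope-fits-shifted {ν} {xs} {μ} a shift

  fits⇔letterFits : Fits (a ∷ xs) ν ⇔ LetterFits a μ
  fits⇔letterFits =
    mk⇔ (λ fits′ k → to (step k) (proj₂ (to (fits-cons a xs ν) fits′) k))
        (λ letterFits → from (fits-cons a xs ν) (fits , λ k → from (step k) (letterFits k)))

proposition2p3 : (x : List Γ) (ν : List ℕ) → IsPartition ν →
    ((∀ k → α k x ≤ + conj ν k - + conj ν (suc k)) →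
       ∃[ μ ] (uWord x ν ≡ just μ × IsPartition μ
               × (∀ k → + conj μ k ≡ + conj ν k + w k x)))
    × (¬ (∀ k → α k x ≤ + conj ν k - + conj ν (suc k)) → uWord x ν ≡ nothing)
proposition2p3 x ν ν-partition = definedIff⇒cases (uWord-spec x ν-partition)
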